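{- Let $G$ be a bipartite graph in which every left node has degree $D$ and which has $(\tfrac 2 3 D + 2)$-expansion up to $K+1$. Let $Y$ be a set of right nodes with $\#Y\le 2K+1$. If $P$ is a set of left nodes such that every $x\in P$ satisfies $\#(\mathcal N(x)\cap Y)\ge D/3$, then $\#P\le K$.
   Context: For a set $S$ of nodes, $\mathcal N(S)$ is the set of all neighbors of elements of $S$ (and $\mathcal N(x)=\mathcal N(\{x\})$). A bipartite graph has $e$-expansion up to $K$ if every set $S$ of left nodes with $\#S\le K$ satisfies $\#\mathcal N(S)\ge e\,\#S$. -}

module Defs where

open import Data.Nat using (ℕ; _*_; _+_; _≤_)
open import Data.Fin using (Fin)
open import Data.Fin.Subset using (Subset; _∈_; ∣_∣; _∩_; inside)
open import Data.Vec using (tabulate; lookup)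
open import Data.Bool using (Bool; true; false; _∧_)
open import Data.List using (allFin)
open import Data.Bool.ListAction using (any)
open import Relation.Binary.PropositionalEquality using (_≡_)

record BipartiteGraph (L R : ℕ) : Set where
  constructor bigraph
  field
    edge : Fin L → Fin R → Bool

open BipartiteGraph public

𝒩 : ∀ {L R} → BipartiteGraph L R → Subset L → Subset R
𝒩 {L} G S = tabulate (λ y → any (λ x → lookup S x ∧ edge G x y) (allFin L))

𝒩₁ : ∀ {L R} → BipartiteGraph L R → Fin L → Subset R
𝒩₁ G x = tabulate (λ y → edge G x y)

LeftRegular : ∀ {L R} → BipartiteGraph L R → ℕ → Set
LeftRegular G D = ∀ x → ∣ 𝒩₁ G x ∣ ≡ D

-- G has ((2/3)D + 2)-expansion up to K: every left set S with #S ≤ K has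
-- #𝒩(S) ≥ ((2/3)D + 2)·#S, written without division (multiply both sides by 3):
--   (2D + 6)·#S ≤ 3·#𝒩(S)
HasExpansion⅔D+2 : ∀ {L R} → BipartiteGraph L R → (D K : ℕ) → Set
HasExpansion⅔D+2 {L} G D K =
  (S : Subset L) → ∣ S ∣ ≤ K → (2 * D + 6) * ∣ S ∣ ≤ 3 * ∣ 𝒩 G S ∣

-- Suppose #P > K and pick S ⊆ P with #S = K + 1. Every x ∈ S has D neighbours, at least D/3 of
-- them in Y, so adding 𝒩(x) to a set containing Y adds at most 2D/3 new right nodes. Hence
-- #𝒩(S) ≤ #(Y ∪ 𝒩(S)) ≤ #Y + (2/3)D(K+1) ≤ 2K + 1 + (2/3)D(K+1), while expansion gives
-- #𝒩(S) ≥ ((2/3)D + 2)(K + 1), which is larger by 1.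
module Submission where

open import Defs
open import Data.Nat using (ℕ; _+_; _*_; _≤_; suc; zero; s≤s)
open import Data.Nat.Properties
open import Data.Nat.Tactic.RingSolver using (solve-∀)
open import Data.Fin using (Fin)
open import Data.Fin.Subset using (Subset; _∈_; _⊆_; ∣_∣; _∩_; _∪_; ⋃; ⊥; inside; outside)
open import Data.Fin.Subset.Properties
  using (s⊆s; ⊥⊆; ∣⊥∣≡0; p⊆q⇒∣p∣≤∣q∣; p⊆p∪q; q⊆p∪q; x∈p∩q⁺; x∈p∩q⁻; ∪-assoc; ∪-identityˡ)
open import Data.Vec using ([]; _∷_; lookup; here; there)
open import Data.Vec.Properties using (lookup∘tabulate; lookup⇒[]=; []=⇒lookup)
open import Data.List using (List; map; length; allFin) renaming ([] to []ₗ; _∷_ to _∷ₗ_)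
open import Data.List.Properties using (length-map)
open import Data.List.Membership.Propositional using () renaming (_∈_ to _∈ₗ_)
open import Data.List.Membership.Propositional.Properties using (∈-map⁺; ∈-map⁻)
open import Data.List.Relation.Unary.Any as Any using (satisfied)
open import Data.List.Relation.Unary.Any.Properties using (any⁻)
open import Data.Bool using (T; _∧_)
open import Data.Bool.ListAction using (any)
open import Data.Bool.Properties using (T-∧; T-≡)
open import Data.Product using (∃-syntax; _×_; _,_)
open import Function using (Equivalence; _∘_)
open import Relation.Binary.PropositionalEquality

private
  variable
    n : ℕ

∣p∪q∣+∣p∩q∣≡∣p∣+∣q∣ : (p q : Subset n) → ∣ p ∪ q ∣ + ∣ p ∩ q ∣ ≡ ∣ p ∣ + ∣ q ∣
∣p∪q∣+∣p∩q∣≡∣p∣+∣q∣ []            []            = refl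
∣p∪q∣+∣p∩q∣≡∣p∣+∣q∣ (inside  ∷ p) (inside  ∷ q) = cong suc (begin
  ∣ p ∪ q ∣ + suc ∣ p ∩ q ∣  ≡⟨ +-suc ∣ p ∪ q ∣ ∣ p ∩ q ∣ ⟩
  suc (∣ p ∪ q ∣ + ∣ p ∩ q ∣) ≡⟨ cong suc (∣p∪q∣+∣p∩q∣≡∣p∣+∣q∣ p q) ⟩
  suc (∣ p ∣ + ∣ q ∣)         ≡⟨ +-suc ∣ p ∣ ∣ q ∣ ⟨
  ∣ p ∣ + suc ∣ q ∣           ∎)
  where open ≡-Reasoning
∣p∪q∣+∣p∩q∣≡∣p∣+∣q∣ (inside  ∷ p) (outside ∷ q) = cong suc (∣p∪q∣+∣p∩q∣≡∣p∣+∣q∣ p q)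
∣p∪q∣+∣p∩q∣≡∣p∣+∣q∣ (outside ∷ p) (inside  ∷ q) =
  trans (cong suc (∣p∪q∣+∣p∩q∣≡∣p∣+∣q∣ p q)) (sym (+-suc ∣ p ∣ ∣ q ∣))
∣p∪q∣+∣p∩q∣≡∣p∣+∣q∣ (outside ∷ p) (outside ∷ q) = ∣p∪q∣+∣p∩q∣≡∣p∣+∣q∣ p q

∩-monoʳ-⊆ : {p q r : Subset n} → q ⊆ r → p ∩ q ⊆ p ∩ r
∩-monoʳ-⊆ {p = p} {q} q⊆r x∈p∩q with x∈p∩q⁻ p q x∈p∩q
... | x∈p , x∈q = x∈p∩q⁺ (x∈p , q⊆r x∈q)

-- Only the part of p outside r can be new in p ∪ q.
∣p∪q∣+∣p∩r∣≤∣q∣+∣p∣ : (p : Subset n) {q r : Subset n} → r ⊆ q → ∣ p ∪ q ∣ + ∣ p ∩ r ∣ ≤ ∣ q ∣ + ∣ p ∣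
∣p∪q∣+∣p∩r∣≤∣q∣+∣p∣ p {q} {r} r⊆q = begin
  ∣ p ∪ q ∣ + ∣ p ∩ r ∣ ≤⟨ +-monoʳ-≤ ∣ p ∪ q ∣ (p⊆q⇒∣p∣≤∣q∣ (∩-monoʳ-⊆ {p = p} r⊆q)) ⟩
  ∣ p ∪ q ∣ + ∣ p ∩ q ∣ ≡⟨ ∣p∪q∣+∣p∩q∣≡∣p∣+∣q∣ p q ⟩
  ∣ p ∣ + ∣ q ∣         ≡⟨ +-comm ∣ p ∣ ∣ q ∣ ⟩
  ∣ q ∣ + ∣ p ∣         ∎
  where open ≤-Reasoning

∣⋃ps∪q∣≤ : (c d : ℕ) (ps : List (Subset n)) (q : Subset n) →
           (∀ {p} → p ∈ₗ ps → c * ∣ p ∣ ≤ c * ∣ p ∩ q ∣ + d) →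
           c * ∣ ⋃ ps ∪ q ∣ ≤ c * ∣ q ∣ + length ps * d
∣⋃ps∪q∣≤ c d []ₗ q _ = ≤-reflexive (begin
  c * ∣ ⊥ ∪ q ∣   ≡⟨ cong (λ s → c * ∣ s ∣) (∪-identityˡ q) ⟩
  c * ∣ q ∣       ≡⟨ +-identityʳ (c * ∣ q ∣) ⟨
  c * ∣ q ∣ + 0   ∎)
  where open ≡-Reasoning
∣⋃ps∪q∣≤ {n} c d (p ∷ₗ ps) q bound = +-cancelʳ-≤ (c * ∣ p ∩ q ∣) _ _ (begin
  c * ∣ (p ∪ ⋃ ps) ∪ q ∣ + c * ∣ p ∩ q ∣  ≡⟨ cong (λ s → c * ∣ s ∣ + c * ∣ p ∩ q ∣) (∪-assoc p (⋃ ps) q) ⟩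
  c * ∣ p ∪ u ∣ + c * ∣ p ∩ q ∣           ≡⟨ *-distribˡ-+ c ∣ p ∪ u ∣ ∣ p ∩ q ∣ ⟨
  c * (∣ p ∪ u ∣ + ∣ p ∩ q ∣)             ≤⟨ *-monoʳ-≤ c (∣p∪q∣+∣p∩r∣≤∣q∣+∣p∣ p (q⊆p∪q (⋃ ps) q)) ⟩
  c * (∣ u ∣ + ∣ p ∣)                     ≡⟨ *-distribˡ-+ c ∣ u ∣ ∣ p ∣ ⟩
  c * ∣ u ∣ + c * ∣ p ∣                   ≤⟨ +-mono-≤ (∣⋃ps∪q∣≤ c d ps q (bound ∘ Any.there)) (bound (Any.here refl)) ⟩
  (c * ∣ q ∣ + length ps * d) + (c * ∣ p ∩ q ∣ + d)
    ≡⟨ regroup (c * ∣ q ∣) (length ps * d) (c * ∣ p ∩ q ∣) d ⟩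
  (c * ∣ q ∣ + suc (length ps) * d) + c * ∣ p ∩ q ∣ ∎)
  where
  open ≤-Reasoning
  u : Subset n
  u = ⋃ ps ∪ q
  regroup : ∀ a b x d → (a + b) + (x + d) ≡ (a + (d + b)) + x
  regroup = solve-∀

⊆⋃ : {p : Subset n} {ps : List (Subset n)} → p ∈ₗ ps → p ⊆ ⋃ ps
⊆⋃ {ps = p ∷ₗ ps} (Any.here refl) = p⊆p∪q (⋃ ps)
⊆⋃ {ps = q ∷ₗ ps} (Any.there p∈ps) = q⊆p∪q q (⋃ ps) ∘ ⊆⋃ p∈ps

∃⊆-of-size : ∀ {k} (p : Subset n) → k ≤ ∣ p ∣ → ∃[ q ] q ⊆ p × ∣ q ∣ ≡ k
∃⊆-of-size {n} {zero} p _ = ⊥ , ⊥⊆ , ∣⊥∣≡0 n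
∃⊆-of-size {k = suc k} (inside ∷ p) (s≤s k≤∣p∣) with ∃⊆-of-size p k≤∣p∣
... | q , q⊆p , ∣q∣≡k = inside ∷ q , s⊆s q⊆p , cong suc ∣q∣≡k
∃⊆-of-size {k = suc k} (outside ∷ p) k≤∣p∣ with ∃⊆-of-size p k≤∣p∣
... | q , q⊆p , ∣q∣≡k = outside ∷ q , s⊆s q⊆p , ∣q∣≡k

elements : Subset n → List (Fin n)
elements []            = []ₗ
elements (inside  ∷ p) = Fin.zero ∷ₗ map Fin.suc (elements p)
elements (outside ∷ p) = map Fin.suc (elements p)

length-elements : (p : Subset n) → length (elements p) ≡ ∣ p ∣
length-elements []            = refl
length-elements (inside  ∷ p) = cong suc (trans (length-map Fin.suc (elements p)) (length-elements p))
length-elements (outside ∷ p) = trans (length-map Fin.suc (elements p)) (length-elements p)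

∈-elements⁺ : {x : Fin n} {p : Subset n} → x ∈ p → x ∈ₗ elements p
∈-elements⁺ {p = inside  ∷ p} here        = Any.here refl
∈-elements⁺ {p = inside  ∷ p} (there x∈p) = Any.there (∈-map⁺ Fin.suc (∈-elements⁺ x∈p))
∈-elements⁺ {p = outside ∷ p} (there x∈p) = ∈-map⁺ Fin.suc (∈-elements⁺ x∈p)

∈-elements⁻ : {x : Fin n} {p : Subset n} → x ∈ₗ elements p → x ∈ p
∈-elements⁻ {p = inside  ∷ p} (Any.here refl) = here
∈-elements⁻ {p = inside  ∷ p} (Any.there x∈) with ∈-map⁻ Fin.suc x∈
... | _ , y∈ , refl = there (∈-elements⁻ y∈)
∈-elements⁻ {p = outside ∷ p} x∈ with ∈-map⁻ Fin.suc x∈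
... | _ , y∈ , refl = there (∈-elements⁻ y∈)

T-lookup⇒∈ : {p : Subset n} {x : Fin n} → T (lookup p x) → x ∈ p
T-lookup⇒∈ {p = p} {x} t = lookup⇒[]= x p (Equivalence.to T-≡ t)

module _ {L R : ℕ} (G : BipartiteGraph L R) where

  ∈𝒩⁻ : (S : Subset L) {y : Fin R} → y ∈ 𝒩 G S → ∃[ x ] x ∈ S × y ∈ 𝒩₁ G x
  ∈𝒩⁻ S {y} y∈𝒩S with satisfied (any⁻ _ (allFin L) some-x)
    where
    some-x : T (any (λ x → lookup S x ∧ edge G x y) (allFin L))
    some-x = Equivalence.from T-≡ (trans (sym (lookup∘tabulate _ y)) ([]=⇒lookup y∈𝒩S))
  ... | x , x∈S∧x~y with Equivalence.to T-∧ x∈S∧x~y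
  ... | x∈S , x~y = x , T-lookup⇒∈ x∈S , T-lookup⇒∈ (subst T (sym (lookup∘tabulate (edge G x) y)) x~y)

  𝒩⊆⋃𝒩₁ : (S : Subset L) → 𝒩 G S ⊆ ⋃ (map (𝒩₁ G) (elements S))
  𝒩⊆⋃𝒩₁ S y∈𝒩S with ∈𝒩⁻ S y∈𝒩S
  ... | x , x∈S , y∈𝒩₁x = ⊆⋃ (∈-map⁺ (𝒩₁ G) (∈-elements⁺ x∈S)) y∈𝒩₁x

  -- Each x ∈ S has at most D − D/3 neighbours outside Y.
  3∣𝒩S∣≤ : ∀ {D} (Y : Subset R) (S : Subset L) → LeftRegular G D →
           (∀ x → x ∈ S → D ≤ 3 * ∣ 𝒩₁ G x ∩ Y ∣) →
           3 * ∣ 𝒩 G S ∣ ≤ 3 * ∣ Y ∣ + ∣ S ∣ * (2 * D)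
  3∣𝒩S∣≤ {D} Y S regular dense = begin
    3 * ∣ 𝒩 G S ∣            ≤⟨ *-monoʳ-≤ 3 (p⊆q⇒∣p∣≤∣q∣ (p⊆p∪q Y ∘ 𝒩⊆⋃𝒩₁ S)) ⟩
    3 * ∣ ⋃ As ∪ Y ∣         ≤⟨ ∣⋃ps∪q∣≤ 3 (2 * D) As Y new-≤ ⟩
    3 * ∣ Y ∣ + length As * (2 * D)
      ≡⟨ cong (λ k → 3 * ∣ Y ∣ + k * (2 * D)) (trans (length-map (𝒩₁ G) (elements S)) (length-elements S)) ⟩
    3 * ∣ Y ∣ + ∣ S ∣ * (2 * D) ∎
    where
    open ≤-Reasoning
    As : List (Subset R)
    As = map (𝒩₁ G) (elements S)
    new-≤ : ∀ {p} → p ∈ₗ As → 3 * ∣ p ∣ ≤ 3 * ∣ p ∩ Y ∣ + 2 * D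
    new-≤ p∈As with ∈-map⁻ (𝒩₁ G) p∈As
    ... | x , x∈S , refl rewrite regular x = +-monoˡ-≤ (2 * D) (dense x (∈-elements⁻ x∈S))

lemma5 : ∀ {L R} (G : BipartiteGraph L R) (D K : ℕ) →
         LeftRegular G D →
         HasExpansion⅔D+2 G D (suc K) →
         (Y : Subset R) → ∣ Y ∣ ≤ 2 * K + 1 →
         (P : Subset L) →
         (∀ x → x ∈ P → D ≤ 3 * ∣ 𝒩₁ G x ∩ Y ∣) →
         ∣ P ∣ ≤ K
lemma5 G D K regular expanding Y ∣Y∣≤ P dense = ≮⇒≥ λ K<∣P∣ →
  let S , S⊆P , ∣S∣≡1+K = ∃⊆-of-size P K<∣P∣ in
  m+1+n≰m budget (begin
    budget + 3                     ≡⟨ expansion≡budget+3 D K ⟨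
    (2 * D + 6) * suc K            ≡⟨ cong ((2 * D + 6) *_) ∣S∣≡1+K ⟨
    (2 * D + 6) * ∣ S ∣            ≤⟨ expanding S (≤-reflexive ∣S∣≡1+K) ⟩
    3 * ∣ 𝒩 G S ∣                  ≤⟨ 3∣𝒩S∣≤ G Y S regular (λ x → dense x ∘ S⊆P) ⟩
    3 * ∣ Y ∣ + ∣ S ∣ * (2 * D)    ≡⟨ cong (λ k → 3 * ∣ Y ∣ + k * (2 * D)) ∣S∣≡1+K ⟩
    3 * ∣ Y ∣ + suc K * (2 * D)    ≤⟨ +-monoˡ-≤ (suc K * (2 * D)) (*-monoʳ-≤ 3 ∣Y∣≤) ⟩
    budget                         ∎)
  where
  open ≤-Reasoning
  budget : ℕ
  budget = 3 * (2 * K + 1) + suc K * (2 * D)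
  expansion≡budget+3 : ∀ D K → (2 * D + 6) * suc K ≡ (3 * (2 * K + 1) + suc K * (2 * D)) + 3
  expansion≡budget+3 = solve-∀
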